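{- Let $\mathcal{F}$ be a disjointness-compliable family of subsets of the node set $V$ of a graph $G=(V,E)$ and let $S\subseteq E$ be an edge set. (1) If $S$ covers the halo-family $\mathcal{F}(C)$ for some $\mathcal{F}$-core $C$, then $\Delta(S)\ge1$. (2) If $S$ is (the edge set of) a tree whose node set intersects each of $p\ge2$ distinct $\mathcal{F}$-cores, then $\Delta(S)\ge p-1\ge p/2$.
   Context: An edge covers $A\subset V$ if it has exactly one end in $A$; an edge set covers $A$ if one of its edges does, and covers a family if it covers every member. $\mathcal{F}$ is disjointness-compliable if $A'\subseteq A\in\mathcal{F}$ implies $A'\in\mathcal{F}$ or $A\setminus A'\in\mathcal{F}$. An $\mathcal{F}$-core is an inclusion-minimal member of $\mathcal{F}$; the halo-family $\mathcal{F}(C)$ of a core $C$ is the family of members of $\mathcal{F}$ containing no core other than $C$. For $S\subseteq E$, $\mathcal{F}^S$ is the family of members of $\mathcal{F}$ not covered by $S$, $\nu(S)$ is the number of inclusion-minimal members of $\mathcal{F}^S$, $\nu_0=\nu(\emptyset)$ is the number of $\mathcal{F}$-cores, and $\Delta(S)=\nu_0-\nu(S)$. -}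

module Defs where

open import Data.Nat using (ℕ; zero; suc; _<_; _≤_; _+_)
open import Data.Fin using (Fin)
open import Data.Fin.Subset using (Subset; _∈_; _∉_; _⊆_; _⊂_; _─_; inside; outside; Nonempty)
open import Data.Fin.Subset.Properties using (_∈?_; anySubset?)
open import Data.Vec using ([]; _∷_)
open import Data.List using (List; length; lookup)
open import Data.List.Relation.Unary.Any using (Any; any?)
open import Data.Product using (_×_; _,_; ∃; proj₁; proj₂)
open import Data.Sum using (_⊎_; inj₁; inj₂)
open import Relation.Nullary using (¬_; Dec; yes; no)
open import Relation.Nullary.Decidable using (isYes; _×-dec_; _⊎-dec_; ¬?)
open import Relation.Binary.PropositionalEquality using (_≡_; _≢_)
open import Data.Integer using (ℤ; +_; _-_)

-- Nodes of the graph are Fin n; an edge is a pair of end nodes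
-- (edge sets are lists, so parallel edges are allowed).
Edge : ℕ → Set
Edge n = Fin n × Fin n

-- A family of subsets of V = Fin n, with decidable membership
-- (any family of subsets of a finite set is decidable classically).
Family : ℕ → Set₁
Family n = Subset n → Set

DecFamily : ∀ {n} → Family n → Set
DecFamily {n} F = (A : Subset n) → Dec (F A)

module _ {n : ℕ} where

  CoversE : Edge n → Subset n → Set
  CoversE (u , v) A = (u ∈ A × v ∉ A) ⊎ (u ∉ A × v ∈ A)

  coversE? : (e : Edge n) (A : Subset n) → Dec (CoversE e A)
  coversE? (u , v) A = ((u ∈? A) ×-dec ¬? (v ∈? A)) ⊎-dec (¬? (u ∈? A) ×-dec (v ∈? A))

  Covers : List (Edge n) → Subset n → Set
  Covers S A = Any (λ e → CoversE e A) S

  covers? : (S : List (Edge n)) (A : Subset n) → Dec (Covers S A)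
  covers? S A = any? (λ e → coversE? e A) S

  CoversFam : List (Edge n) → Family n → Set
  CoversFam S G = ∀ A → G A → Covers S A

  DisjointnessCompliable : Family n → Set
  DisjointnessCompliable F = ∀ A A' → F A → A' ⊆ A → F A' ⊎ F (A ─ A')

  Minimal : Family n → Subset n → Set
  Minimal G A = G A × (∀ B → B ⊂ A → ¬ G B)

  Core : Family n → Subset n → Set
  Core F C = Minimal F C

  Halo : Family n → Subset n → Family n
  Halo F C A = F A × (∀ C' → Core F C' → C' ⊆ A → C' ≡ C)

  Uncovered : Family n → List (Edge n) → Family n
  Uncovered F S A = F A × ¬ Covers S A

  uncovered? : ∀ {F} → DecFamily F → (S : List (Edge n)) → DecFamily (Uncovered F S)
  uncovered? F? S A = F? A ×-dec ¬? (covers? S A)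

  minimal? : ∀ {G} → DecFamily G → DecFamily (Minimal G)
  minimal? {G} G? A with G? A | anySubset? (λ B → (B ⊂? A) ×-dec G? B)
    where open import Data.Fin.Subset.Properties using (_⊂?_)
  ... | no ¬g | _ = no (λ m → ¬g (proj₁ m))
  ... | yes g | yes (B , B⊂A , gB) = no (λ m → proj₂ m B B⊂A gB)
  ... | yes g | no ¬ex = yes (g , λ B B⊂A gB → ¬ex (B , B⊂A , gB))

countSubsets : ∀ {n} {P : Subset n → Set} → ((A : Subset n) → Dec (P A)) → ℕ
countSubsets {zero} P? with P? []
... | yes _ = 1
... | no _ = 0
countSubsets {suc n} P? = countSubsets (λ A → P? (inside ∷ A)) + countSubsets (λ A → P? (outside ∷ A))

ν : ∀ {n} (F : Family n) → DecFamily F → List (Edge n) → ℕ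
ν F F? S = countSubsets (minimal? (uncovered? F? S))

Δ : ∀ {n} (F : Family n) → DecFamily F → List (Edge n) → ℤ
Δ F F? S = + ν F F? List.[] - + ν F F? S
  where import Data.List as List

module _ {n : ℕ} where

  Joins : Edge n → Fin n → Fin n → Set
  Joins (a , b) u w = (a ≡ u × b ≡ w) ⊎ (a ≡ w × b ≡ u)

  data Walk (S : List (Edge n)) : Fin n → Fin n → Set where
    here : ∀ {u} → Walk S u u
    step : ∀ {u w v} (i : Fin (length S)) → Joins (lookup S i) u w → Walk S w v → Walk S u v

  record Cycle (S : List (Edge n)) : Set where
    field
      k      : ℕ
      k≥1    : 1 ≤ k
      vtx    : ℕ → Fin n
      edg    : ℕ → Fin (length S)
      joins  : ∀ i → i < k → Joins (lookup S (edg i)) (vtx i) (vtx (suc i))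
      closed : vtx k ≡ vtx 0
      edg-distinct : ∀ i j → i < j → j < k → edg i ≢ edg j
      vtx-distinct : ∀ i j → i < j → j < k → vtx i ≢ vtx j

  IsTree : Subset n → List (Edge n) → Set
  IsTree T S =
    Nonempty T
    × (∀ i → proj₁ (lookup S i) ∈ T × proj₂ (lookup S i) ∈ T)
    × (∀ u v → u ∈ T → v ∈ T → Walk S u v)
    × ¬ Cycle S

{-# OPTIONS --safe #-}
-- Two minimal members of F^S that meet are equal: by disjointness-compliability
-- their intersection, or the first minus the intersection, lies in F; it is
-- uncovered because an edge covering it covers one of the two members; either
-- way minimality forces equality.  Choosing a core inside each minimal member
-- therefore gives ν(S) distinct cores, and ν₀ ≥ ν(S) + m as soon as m further
-- cores avoid all chosen ones.  In (1) the core C can be added: a minimal member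
-- all of whose cores are C lies in the halo of C and would be covered.  In (2)
-- an uncovered set is closed under walks along S, so a minimal member containing
-- some c i contains the whole tree; all such members coincide, so at most one
-- c i is among the chosen cores and the other p − 1 can be added.
module Submission where

open import Defs
open import Data.Bool.Properties using () renaming (_≟_ to _≟ᵇ_)
open import Data.Empty using (⊥-elim)
open import Data.Fin using (Fin; zero; suc; splitAt; _↑ˡ_; _↑ʳ_; punchIn)
open import Data.Fin.Properties using (splitAt-↑ˡ; splitAt-↑ʳ; splitAt⁻¹-↑ˡ; splitAt⁻¹-↑ʳ; +↔⊎; injective⇒≤; punchIn-injective; punchInᵢ≢i; any?)
open import Data.Fin.Subset using (Subset; Side; inside; outside; _∈_; _∉_; _⊆_; _∩_; _─_; ⊥; ∣_∣; Empty)
open import Data.Fin.Subset.Properties using (_∈?_; _⊆?_; _⊂?_; anySubset?; nonempty?; x∈p∩q⁺; x∈p∩q⁻; p∩q⊆p; p∩q⊆q; x∈p∧x∉q⇒x∈p─q; p─q⊆p; p∩q≢∅⇒p─q⊂p; p⊂q⇒p⊆q; p⊂q⇒∣p∣<∣q∣; ⊆-antisym; Empty-unique; ⊥⊆; ∉⊥)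
open import Data.Integer using (+_; _-_; +≤+) renaming (_≤_ to _≤ℤ_)
open import Data.Integer.Properties using (m-n≡m⊖n; ⊖-≥)
open import Data.List using (List; []; lookup)
open import Data.List.Membership.Propositional using (lose) renaming (_∈_ to _∈ₗ_)
open import Data.List.Membership.Propositional.Properties using (∈-lookup)
open import Data.List.Relation.Unary.All using (All)
open import Data.List.Relation.Unary.Any as Any using ()
open import Data.List.Relation.Unary.Any.Properties using (Any-⊎⁻)
open import Data.Nat using (ℕ; zero; suc; _+_; _*_; _∸_; _≤_; _<_; s≤s)
open import Data.Nat.Induction using (<-wellFounded)
open import Data.Nat.Properties using (m+n≤o⇒m≤o∸n; m+n≤o⇒n≤o; m≤n+m; +-identityʳ; module ≤-Reasoning)
open import Data.Product using (_×_; _,_; ∃; proj₁; proj₂; swap)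
open import Data.Sum as Sum using (_⊎_; inj₁; inj₂; [_,_]′)
open import Data.Vec using ([]; _∷_; here; there)
open import Data.Vec.Properties using (≡-dec)
open import Function using (_∘_; id)
open import Function.Bundles using (Injection)
open import Function.Definitions using (Injective)
open import Function.Properties.Inverse using (↔⇒↣)
open import Induction.WellFounded using (Acc; acc)
open import Relation.Binary.Construct.On as On using ()
open import Relation.Binary.Definitions using (DecidableEquality)
open import Relation.Binary.PropositionalEquality using (_≡_; _≢_; refl; sym; trans; cong; subst; module ≡-Reasoning)
open import Relation.Nullary using (¬_; Dec; yes; no; contradiction)
open import Relation.Nullary.Decidable using (_×-dec_; ¬?)
open import Relation.Unary using (Decidable)

private
  variable
    n k : ℕ
    x u v : Fin n
    A B C M M′ : Subset n
    S : List (Edge n)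
    F G : Family n

_≟ₛ_ : DecidableEquality (Subset n)
_≟ₛ_ = ≡-dec _≟ᵇ_

splitAt-injective : ∀ m {n} → Injective _≡_ _≡_ (splitAt m {n})
splitAt-injective m = Injection.injective (↔⇒↣ (+↔⊎ {m}))

m+n≤o⇒m≤o-n : ∀ m n o → m + n ≤ o → + m ≤ℤ + o - + n
m+n≤o⇒m≤o-n m n o m+n≤o = subst (+ m ≤ℤ_) o∸n≡o-n (+≤+ (m+n≤o⇒m≤o∸n m m+n≤o))
  where
  o∸n≡o-n : + (o ∸ n) ≡ + o - + n
  o∸n≡o-n = sym (trans (m-n≡m⊖n o n) (⊖-≥ (m+n≤o⇒n≤o m m+n≤o)))

≤2*pred : ∀ {p} → 2 ≤ p → p ≤ 2 * (p ∸ 1)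
≤2*pred {suc zero} (s≤s ())
≤2*pred {suc (suc m)} _ = s≤s (begin
  suc m              ≤⟨ m≤n+m (suc m) m ⟩
  m + suc m          ≡⟨ cong (_+_ m) (+-identityʳ (suc m)) ⟨
  m + (suc m + 0)    ∎)
  where open ≤-Reasoning

restrict : ∀ {P : Subset (suc n) → Set} (s : Side) → Decidable P → Decidable (P ∘ (s ∷_))
restrict s P? A = P? (s ∷ A)

enumerate : {P : Subset n → Set} (P? : Decidable P) → Fin (countSubsets P?) → Subset n
enumerate {n = zero} P? _ = []
enumerate {n = suc n} P? i with splitAt (countSubsets (restrict inside P?)) i
... | inj₁ j = inside ∷ enumerate (restrict inside P?) j
... | inj₂ j = outside ∷ enumerate (restrict outside P?) j

enumerate-sound : {P : Subset n → Set} (P? : Decidable P) (i : Fin (countSubsets P?))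
                → P (enumerate P? i)
enumerate-sound {n = zero} P? i with P? []
... | yes p = p
enumerate-sound {n = suc n} P? i with splitAt (countSubsets (restrict inside P?)) i
... | inj₁ j = enumerate-sound (restrict inside P?) j
... | inj₂ j = enumerate-sound (restrict outside P?) j

indexOf : {P : Subset n → Set} (P? : Decidable P) (A : Subset n) → P A → Fin (countSubsets P?)
indexOf P? [] p with P? []
... | yes _ = zero
... | no ¬p = contradiction p ¬p
indexOf P? (inside ∷ A) p = indexOf (restrict inside P?) A p ↑ˡ _
indexOf P? (outside ∷ A) p = _ ↑ʳ indexOf (restrict outside P?) A p

enumerate-indexOf : {P : Subset n → Set} (P? : Decidable P) (A : Subset n) (p : P A)
                  → enumerate P? (indexOf P? A p) ≡ A
enumerate-indexOf P? [] p = refl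
enumerate-indexOf P? (inside ∷ A) p
  rewrite splitAt-↑ˡ _ (indexOf (restrict inside P?) A p) (countSubsets (restrict outside P?))
  = cong (inside ∷_) (enumerate-indexOf (restrict inside P?) A p)
enumerate-indexOf P? (outside ∷ A) p
  rewrite splitAt-↑ʳ (countSubsets (restrict inside P?)) _ (indexOf (restrict outside P?) A p)
  = cong (outside ∷_) (enumerate-indexOf (restrict outside P?) A p)

indexOf-enumerate : {P : Subset n → Set} (P? : Decidable P) (i : Fin (countSubsets P?)) {A : Subset n} (p : P A)
                  → enumerate P? i ≡ A → indexOf P? A p ≡ i
indexOf-enumerate {n = zero} P? i p refl with P? []
indexOf-enumerate {n = zero} P? zero p refl | yes _ = refl
indexOf-enumerate {n = suc n} P? i p refl with splitAt (countSubsets (restrict inside P?)) i in split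
... | inj₁ j = trans (cong (_↑ˡ _) (indexOf-enumerate (restrict inside P?) j p refl)) (splitAt⁻¹-↑ˡ split)
... | inj₂ j = trans (cong (_ ↑ʳ_) (indexOf-enumerate (restrict outside P?) j p refl)) (splitAt⁻¹-↑ʳ split)

enumerate-injective : {P : Subset n → Set} (P? : Decidable P) → Injective _≡_ _≡_ (enumerate P?)
enumerate-injective P? {i} {j} eq = trans (sym (indexOf-i≡ i refl)) (indexOf-i≡ j (sym eq))
  where
  indexOf-i≡ : ∀ l → enumerate P? l ≡ enumerate P? i → indexOf P? (enumerate P? i) (enumerate-sound P? i) ≡ l
  indexOf-i≡ l = indexOf-enumerate P? l (enumerate-sound P? i)

injective⇒≤countSubsets : {P : Subset n → Set} (P? : Decidable P) (h : Fin k → Subset n)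
                        → (∀ i → P (h i)) → Injective _≡_ _≡_ h → k ≤ countSubsets P?
injective⇒≤countSubsets P? h Ph h-injective = injective⇒≤ {f = λ i → indexOf P? (h i) (Ph i)} index-injective
  where
  open ≡-Reasoning
  index-injective : Injective _≡_ _≡_ (λ i → indexOf P? (h i) (Ph i))
  index-injective {i} {j} eq = h-injective (begin
    h i                                   ≡⟨ enumerate-indexOf P? (h i) (Ph i) ⟨
    enumerate P? (indexOf P? (h i) (Ph i)) ≡⟨ cong (enumerate P?) eq ⟩
    enumerate P? (indexOf P? (h j) (Ph j)) ≡⟨ enumerate-indexOf P? (h j) (Ph j) ⟩
    h j                                   ∎)

x∉p∩q⇒x∉p⊎x∉q : ∀ {p q : Subset n} → x ∉ p ∩ q → x ∉ p ⊎ x ∉ q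
x∉p∩q⇒x∉p⊎x∉q {x = x} {p = p} x∉p∩q with x ∈? p
... | yes x∈p = inj₂ (λ x∈q → x∉p∩q (x∈p∩q⁺ (x∈p , x∈q)))
... | no x∉p = inj₁ x∉p

x∈p─q⇒x∉q : ∀ {p q : Subset n} → x ∈ p ─ q → x ∉ q
x∈p─q⇒x∉q {p = _ ∷ _} {outside ∷ _} here ()
x∈p─q⇒x∉q {p = _ ∷ _} {_ ∷ _} (there x∈p─q) (there x∈q) = x∈p─q⇒x∉q x∈p─q x∈q

x∉p─q⇒x∉p⊎x∈q : ∀ {p q : Subset n} → x ∉ p ─ q → x ∉ p ⊎ x ∈ q
x∉p─q⇒x∉p⊎x∈q {x = x} {q = q} x∉p─q with x ∈? q
... | yes x∈q = inj₂ x∈q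
... | no x∉q = inj₁ (λ x∈p → x∉p─q (x∈p∧x∉q⇒x∈p─q x∈p x∉q))

∩-separates : u ∈ A ∩ B → v ∉ A ∩ B → (u ∈ A × v ∉ A) ⊎ (u ∈ B × v ∉ B)
∩-separates {A = A} {B} u∈A∩B v∉A∩B = Sum.map (u∈A ,_) (u∈B ,_) (x∉p∩q⇒x∉p⊎x∉q v∉A∩B)
  where
  u∈A = proj₁ (x∈p∩q⁻ A B u∈A∩B)
  u∈B = proj₂ (x∈p∩q⁻ A B u∈A∩B)

─-separates : u ∈ A ─ B → v ∉ A ─ B → (u ∈ A × v ∉ A) ⊎ (v ∈ B × u ∉ B)
─-separates {A = A} {B} u∈A─B v∉A─B =
  Sum.map (p─q⊆p A B u∈A─B ,_) (_, x∈p─q⇒x∉q u∈A─B) (x∉p─q⇒x∉p⊎x∈q v∉A─B)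

coversE-∩ : ∀ (e : Edge n) → CoversE e (A ∩ B) → CoversE e A ⊎ CoversE e B
coversE-∩ (u , v) (inj₁ (u∈ , v∉)) = Sum.map inj₁ inj₁ (∩-separates u∈ v∉)
coversE-∩ (u , v) (inj₂ (u∉ , v∈)) = Sum.map (inj₂ ∘ swap) (inj₂ ∘ swap) (∩-separates v∈ u∉)

coversE-─ : ∀ (e : Edge n) → CoversE e (A ─ B) → CoversE e A ⊎ CoversE e B
coversE-─ (u , v) (inj₁ (u∈ , v∉)) = Sum.map inj₁ (inj₂ ∘ swap) (─-separates u∈ v∉)
coversE-─ (u , v) (inj₂ (u∉ , v∈)) = Sum.map (inj₂ ∘ swap) inj₁ (─-separates v∈ u∉)

uncovered-∩ : ¬ Covers S A → ¬ Covers S B → ¬ Covers S (A ∩ B)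
uncovered-∩ ¬covA ¬covB = [ ¬covA , ¬covB ]′ ∘ Any-⊎⁻ ∘ Any.map (coversE-∩ _)

uncovered-─ : ¬ Covers S A → ¬ Covers S B → ¬ Covers S (A ─ B)
uncovered-─ ¬covA ¬covB = [ ¬covA , ¬covB ]′ ∘ Any-⊎⁻ ∘ Any.map (coversE-─ _)

joins⇒coversE : ∀ {e : Edge n} → Joins e u v → u ∈ A → v ∉ A → CoversE e A
joins⇒coversE (inj₁ (refl , refl)) u∈A v∉A = inj₁ (u∈A , v∉A)
joins⇒coversE (inj₂ (refl , refl)) u∈A v∉A = inj₂ (v∉A , u∈A)

uncovered-walk-closed : ¬ Covers S A → Walk S u v → u ∈ A → v ∈ A
uncovered-walk-closed ¬cov here u∈A = u∈A
uncovered-walk-closed {A = A} ¬cov (step {w = w} i joins walk) u∈A with w ∈? A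
... | yes w∈A = uncovered-walk-closed ¬cov walk w∈A
... | no w∉A = contradiction (lose (∈-lookup i) (joins⇒coversE joins u∈A w∉A)) ¬cov

minimal-⊆⇒≡ : Minimal G A → G B → B ⊆ A → B ≡ A
minimal-⊆⇒≡ {A = A} {B = B} (_ , minimalA) GB B⊆A = ⊆-antisym B⊆A A⊆B
  where
  A⊆B : A ⊆ B
  A⊆B {x} x∈A with x ∈? B
  ... | yes x∈B = x∈B
  ... | no x∉B = contradiction GB (minimalA B (B⊆A , x , x∈A , x∉B))

minimal-⊆ : DecFamily G → G A → ∃ λ M → Minimal G M × M ⊆ A
minimal-⊆ {G = G} {A = A} G? = go A (On.wellFounded ∣_∣ <-wellFounded A)
  where
  go : ∀ A → Acc (λ B A → ∣ B ∣ < ∣ A ∣) A → G A → ∃ λ M → Minimal G M × M ⊆ A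
  go A (acc smaller) GA with anySubset? (λ B → B ⊂? A ×-dec G? B)
  ... | no ∄B = A , (GA , λ B B⊂A GB → ∄B (B , B⊂A , GB)) , id
  ... | yes (B , B⊂A , GB) with go B (smaller (p⊂q⇒∣p∣<∣q∣ B⊂A)) GB
  ...   | M , minimalM , M⊆B = M , minimalM , p⊂q⇒p⊆q B⊂A ∘ M⊆B

minimal-Empty-unique : Minimal G A → Minimal G B → Empty A → A ≡ B
minimal-Empty-unique {B = B} (GA , _) (_ , minimalB) emptyA with Empty-unique emptyA | nonempty? B
... | refl | yes (x , x∈B) = contradiction GA (minimalB ⊥ (⊥⊆ , x , x∈B , ∉⊥))
... | refl | no emptyB = sym (Empty-unique emptyB)

core⇒minimal-uncovered : Core F C → Minimal (Uncovered F []) C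
core⇒minimal-uncovered (FC , minimalC) = (FC , λ ()) , λ B B⊂C (FB , _) → minimalC B B⊂C FB

minimal-uncovered-meet⇒≡ : DisjointnessCompliable F → Minimal (Uncovered F S) M → Minimal (Uncovered F S) M′
                         → x ∈ M → x ∈ M′ → M ≡ M′
minimal-uncovered-meet⇒≡ {M = M} {M′ = M′} {x = x} dc
  minimalM@((FM , ¬covM) , below-M) minimalM′@((_ , ¬covM′) , _) x∈M x∈M′
  with dc M (M ∩ M′) FM (p∩q⊆p M M′)
... | inj₁ F[M∩M′] = minimal-⊆⇒≡ minimalM′ (FM , ¬covM) M⊆M′
  where
  M∩M′≡M : M ∩ M′ ≡ M
  M∩M′≡M = minimal-⊆⇒≡ minimalM (F[M∩M′] , uncovered-∩ ¬covM ¬covM′) (p∩q⊆p M M′)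
  M⊆M′ : M ⊆ M′
  M⊆M′ y∈M = p∩q⊆q M M′ (subst (_ ∈_) (sym M∩M′≡M) y∈M)
... | inj₂ F[M─M∩M′] = contradiction
  (F[M─M∩M′] , uncovered-─ ¬covM (uncovered-∩ ¬covM ¬covM′))
  (below-M _ (p∩q≢∅⇒p─q⊂p M (M ∩ M′) (x , x∈p∩q⁺ (x∈M , x∈p∩q⁺ (x∈M , x∈M′)))))

module _ {F : Family n} (F? : DecFamily F) (dc : DisjointnessCompliable F) (S : List (Edge n)) where

  HasCoreAvoiding : ∀ {m} → (Fin m → Subset n) → Subset n → Set
  HasCoreAvoiding d M = ∃ λ K → Core F K × K ⊆ M × (∀ j → d j ≢ K)

  cores+ν≤ν₀ : ∀ {m} (d : Fin (suc m) → Subset n) → Injective _≡_ _≡_ d → (∀ j → Core F (d j))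
             → (∀ {M} → Minimal (Uncovered F S) M → HasCoreAvoiding d M)
             → suc m + ν F F? S ≤ ν F F? []
  cores+ν≤ν₀ {m} d d-injective d-core avoiding =
    injective⇒≤countSubsets (minimal? (uncovered? F? [])) (cores ∘ splitAt (suc m))
      (core⇒minimal-uncovered ∘ cores-core ∘ splitAt (suc m))
      (λ eq → splitAt-injective (suc m) (cores-injective eq))
    where
    P? = minimal? (uncovered? F? S)
    member = enumerate P?
    chosen : ∀ i → HasCoreAvoiding d (member i)
    chosen i = avoiding (enumerate-sound P? i)
    K : Fin (ν F F? S) → Subset n
    K i = proj₁ (chosen i)
    K-core : ∀ i → Core F (K i)
    K-core i = proj₁ (proj₂ (chosen i))
    K⊆member : ∀ i → K i ⊆ member i
    K⊆member i = proj₁ (proj₂ (proj₂ (chosen i)))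
    K-avoids : ∀ i j → d j ≢ K i
    K-avoids i = proj₂ (proj₂ (proj₂ (chosen i)))

    K-injective : Injective _≡_ _≡_ K
    K-injective {i} {i′} eq with nonempty? (K i)
    ... | yes (x , x∈K) = enumerate-injective P?
      (minimal-uncovered-meet⇒≡ dc (enumerate-sound P? i) (enumerate-sound P? i′)
        (K⊆member i x∈K) (K⊆member i′ (subst (x ∈_) eq x∈K)))
    ... | no empty = contradiction (sym (minimal-Empty-unique (K-core i) (d-core zero) empty)) (K-avoids i zero)

    cores : Fin (suc m) ⊎ Fin (ν F F? S) → Subset n
    cores = [ d , K ]′

    cores-core : ∀ s → Core F (cores s)
    cores-core (inj₁ j) = d-core j
    cores-core (inj₂ i) = K-core i

    cores-injective : Injective _≡_ _≡_ cores
    cores-injective {inj₁ j} {inj₁ j′} eq = cong inj₁ (d-injective eq)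
    cores-injective {inj₁ j} {inj₂ i} eq = contradiction eq (K-avoids i j)
    cores-injective {inj₂ i} {inj₁ j} eq = contradiction (sym eq) (K-avoids i j)
    cores-injective {inj₂ i} {inj₂ i′} eq = cong inj₂ (K-injective eq)

  core-outside-halo : F M → ¬ Halo F C M → ∃ λ K → Core F K × K ⊆ M × K ≢ C
  core-outside-halo {M = M} {C = C} FM ∉halo
    with anySubset? (λ K → minimal? F? K ×-dec K ⊆? M ×-dec ¬? (K ≟ₛ C))
  ... | yes found = found
  ... | no none = contradiction (FM , only-C) ∉halo
    where
    only-C : ∀ K → Core F K → K ⊆ M → K ≡ C
    only-C K K-core K⊆M with K ≟ₛ C
    ... | yes K≡C = K≡C
    ... | no K≢C = ⊥-elim (none (K , K-core , K⊆M , K≢C))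

  halo-covered⇒Δ≥1 : Core F C → CoversFam S (Halo F C) → + 1 ≤ℤ Δ F F? S
  halo-covered⇒Δ≥1 {C = C} C-core covers =
    m+n≤o⇒m≤o-n 1 _ _ (cores+ν≤ν₀ just-C just-C-injective (λ _ → C-core) avoiding)
    where
    just-C : Fin 1 → Subset n
    just-C _ = C
    just-C-injective : Injective _≡_ _≡_ just-C
    just-C-injective {zero} {zero} _ = refl
    avoiding : Minimal (Uncovered F S) M → HasCoreAvoiding just-C M
    avoiding ((FM , ¬covM) , _) with core-outside-halo FM (¬covM ∘ covers _)
    ... | K , K-core , K⊆M , K≢C = K , K-core , K⊆M , λ _ → K≢C ∘ sym

  module _ {T : Subset n} {m : ℕ} {c : Fin (suc (suc m)) → Subset n}
           (connected : ∀ u v → u ∈ T → v ∈ T → Walk S u v)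
           (c-injective : Injective _≡_ _≡_ c) (c-core : ∀ j → Core F (c j))
           (c-meets-T : ∀ j → ∃ λ v → v ∈ c j × v ∈ T) where

    T⊆uncovered : ¬ Covers S M → v ∈ M → v ∈ T → T ⊆ M
    T⊆uncovered ¬covM v∈M v∈T t∈T = uncovered-walk-closed ¬covM (connected _ _ v∈T t∈T) v∈M

    hosts-coincide : ∀ {j j′} → Minimal (Uncovered F S) M → Minimal (Uncovered F S) M′
                   → c j ⊆ M → c j′ ⊆ M′ → M ≡ M′
    hosts-coincide {j = j} {j′} minimalM minimalM′ cj⊆M cj′⊆M′ with c-meets-T j | c-meets-T j′
    ... | v , v∈cj , v∈T | v′ , v′∈cj′ , v′∈T =
      minimal-uncovered-meet⇒≡ dc minimalM minimalM′ (cj⊆M v∈cj)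
        (T⊆uncovered (proj₂ (proj₁ minimalM′)) (cj′⊆M′ v′∈cj′) v′∈T v∈T)

    Host : Set
    Host = ∃ λ M → Minimal (Uncovered F S) M × ∃ λ j → c j ⊆ M

    host? : Dec Host
    host? = anySubset? (λ M → minimal? (uncovered? F? S) M ×-dec any? (λ j → c j ⊆? M))

    -- By hosts-coincide a single minimal member contains all the c j that lie in
    -- minimal members, so only the index of the core chosen inside it is left out.
    spared : Dec Host → Fin (suc (suc m))
    spared (yes (_ , _ , j , _)) = j
    spared (no _) = zero

    avoiding : (host : Dec Host) → Minimal (Uncovered F S) M
             → HasCoreAvoiding (c ∘ punchIn (spared host)) M
    avoiding {M = M} host minimalM with any? (λ j → c j ⊆? M)
    avoiding (yes (_ , minimalM* , j , cj⊆M*)) minimalM | yes (_ , cj′⊆M) =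
      c j , c-core j , subst (c j ⊆_) (hosts-coincide minimalM* minimalM cj⊆M* cj′⊆M) cj⊆M* ,
      λ l → punchInᵢ≢i j l ∘ c-injective
    avoiding (no no-host) minimalM | yes (j , cj⊆M) = ⊥-elim (no-host (_ , minimalM , j , cj⊆M))
    avoiding host minimalM | no none with minimal-⊆ F? (proj₁ (proj₁ minimalM))
    ... | K , K-core , K⊆M =
      K , K-core , K⊆M , λ l cl≡K → none (punchIn (spared host) l , subst (_⊆ _) (sym cl≡K) K⊆M)

    connected-meets-cores⇒Δ≥p-1 : + suc m ≤ℤ Δ F F? S
    connected-meets-cores⇒Δ≥p-1 = m+n≤o⇒m≤o-n (suc m) _ _
      (cores+ν≤ν₀ (c ∘ punchIn j₀) (punchIn-injective j₀ _ _ ∘ c-injective) (c-core ∘ punchIn j₀)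
                  (avoiding host?))
      where
      j₀ = spared host?

  tree-meets-cores⇒Δ≥p-1 : (T : Subset n) (p : ℕ) (c : Fin p → Subset n) → IsTree T S → 2 ≤ p
                         → Injective _≡_ _≡_ c → (∀ i → Core F (c i)) → (∀ i → ∃ λ v → v ∈ c i × v ∈ T)
                         → + (p ∸ 1) ≤ℤ Δ F F? S
  tree-meets-cores⇒Δ≥p-1 T (suc zero) c _ (s≤s ())
  tree-meets-cores⇒Δ≥p-1 T (suc (suc m)) c (_ , _ , connected , _) _ = connected-meets-cores⇒Δ≥p-1 connected

lemma14 : (n : ℕ) (E S : List (Edge n)) (F : Family n) (F? : DecFamily F)
          → DisjointnessCompliable F
          → All (λ e → e ∈ₗ E) S
          → ((∃ λ C → Core F C × CoversFam S (Halo F C)) → + 1 ≤ℤ Δ F F? S)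
            × ((T : Subset n) (p : ℕ) (c : Fin p → Subset n)
               → IsTree T S
               → 2 ≤ p
               → Injective _≡_ _≡_ c
               → (∀ i → Core F (c i))
               → (∀ i → ∃ λ v → v ∈ c i × v ∈ T)
               → (+ (p ∸ 1) ≤ℤ Δ F F? S) × (p ≤ 2 * (p ∸ 1)))
lemma14 n E S F F? dc _ =
  (λ (C , C-core , covers) → halo-covered⇒Δ≥1 F? dc S C-core covers) ,
  λ T p c tree 2≤p c-injective c-core c-meets-T →
    tree-meets-cores⇒Δ≥p-1 F? dc S T p c tree 2≤p c-injective c-core c-meets-T , ≤2*pred 2≤p
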